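{- Let $\boldsymbol{k}$ be a field and let $\phi=[0;A_1(X),A_2(X),A_3(X),\ldots]\in\overline{\boldsymbol{k}((X^{ -1}))}$, where $A_i(X)=u_iX+v_i$ with $u_i\in\boldsymbol{k}\setminus\{0\}$ and $v_i\in\boldsymbol{k}$ for all $i\ge 1$. Let $(F_n(X))_{n\ge 0}$ be the associated Fibonacci polynomials. Let $n(X)\in\boldsymbol{k}[X]\setminus\{0\}$ have $\phi$-Zeckendorf representation $n(X)=\sum_{i=0}^r z_iF_i(X)$. Then $$\nu_\infty(\{n(X)\phi\})=-j-1,$$ where $j\in\{0,\ldots,r\}$ is the smallest index with $z_j\neq 0$.
   Context: $\boldsymbol{k}((X^{ -1}))$ denotes the field of formal Laurent series $\sum_{i\ge u}c_iX^{ -i}$ ($c_i\in\boldsymbol{k}$). For $L=\sum_{i\ge u}c_iX^{ -i}\neq 0$ with $c_u\neq 0$, the degree valuation is $\nu_\infty(L)=-u$ (and $\nu_\infty(0)=-\infty$). The polynomial part $[L]$ is $\sum_{i\le 0}c_iX^{ -i}\in\boldsymbol{k}[X]$ and the fractional part is $\{L\}=L-[L]=\sum_{i\ge1}c_iX^{ -i}$; $\overline{\boldsymbol{k}((X^{ -1}))}$ is the set of $L$ with $\nu_\infty(L)<0$, i.e. $L=\sum_{i\ge1}c_iX^{ -i}$. The continued fraction $[0;A_1,A_2,\ldots]$ is $\cfrac{1}{A_1+\cfrac{1}{A_2+\cdots}}$. The Fibonacci polynomials associated with $\phi$ are defined by $F_{ -1}(X)=0$, $F_0(X)=1$, $F_n(X)=A_n(X)F_{n-1}(X)+F_{n-2}(X)$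 for $n\ge1$; they satisfy $\deg F_n=n$. Hence every polynomial $P(X)$ of degree $r\ge 0$ can be written uniquely as $P(X)=\sum_{i=0}^r z_iF_i(X)$ with $z_i\in\boldsymbol{k}$ (and $z_r\ne0$); this is the $\phi$-Zeckendorf representation of $P$. -}

module Defs where

open import Level using (_⊔_)
open import Algebra.Bundles using (CommutativeRing)
open import Data.Nat as ℕ using (ℕ; zero; suc; _∸_; _<?_)
open import Data.Integer as ℤ using (ℤ; +_; -[1+_])
open import Data.Product using (Σ; ∃; _×_; _,_; proj₁; proj₂)
open import Relation.Nullary using (¬_; yes; no)

record Field (c ℓ : Level.Level) : Set (Level.suc (c ⊔ ℓ)) where
  field
    commutativeRing : CommutativeRing c ℓ
  open CommutativeRing commutativeRing public
  field
    1≉0     : ¬ (1# ≈ 0#)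
    inverse : ∀ x → ¬ (x ≈ 0#) → ∃ λ y → x * y ≈ 1#

module LaurentSeries {c ℓ} (R : CommutativeRing c ℓ) where
  open CommutativeRing R

  -- A Laurent series is represented by a "top" exponent e and a coefficient
  -- sequence a, standing for  Σ_{i ≥ 0} a i · X^{e - i}.
  record Laurent : Set c where
    constructor mkL
    field
      top : ℕ
      co  : ℕ → Carrier
  open Laurent public

  coeff : Laurent → ℤ → Carrier
  coeff (mkL e a) z with (+ e) ℤ.- z
  ... | + i      = a i
  ... | -[1+ _ ] = 0#

  _≋_ : Laurent → Laurent → Set ℓ
  L ≋ M = ∀ z → coeff L z ≈ coeff M z

  shiftSeq : ℕ → (ℕ → Carrier) → ℕ → Carrier
  shiftSeq zero    a i       = a i
  shiftSeq (suc k) a zero    = 0#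
  shiftSeq (suc k) a (suc i) = shiftSeq k a i

  sumTo : ℕ → (ℕ → Carrier) → Carrier
  sumTo zero    f = f 0
  sumTo (suc n) f = sumTo n f + f (suc n)

  0L : Laurent
  0L = mkL 0 (λ _ → 0#)

  1L : Laurent
  1L = mkL 0 (λ { zero → 1# ; (suc _) → 0# })

  constL : Carrier → Laurent
  constL x = mkL 0 (λ { zero → x ; (suc _) → 0# })

  linL : Carrier → Carrier → Laurent
  linL u v = mkL 1 (λ { zero → u ; (suc zero) → v ; (suc (suc _)) → 0# })

  _+L_ : Laurent → Laurent → Laurent
  mkL e a +L mkL f b = mkL (e ℕ.+ f) (λ i → shiftSeq f a i + shiftSeq e b i)

  _*L_ : Laurent → Laurent → Laurent
  mkL e a *L mkL f b = mkL (e ℕ.+ f) (λ n → sumTo n (λ k → a k * b (n ∸ k)))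

  -- fractional part {L}: keep only the terms X^{z} with z < 0
  frac : Laurent → Laurent
  frac (mkL e a) = mkL e (λ i → keep i)
    where
    keep : ℕ → Carrier
    keep i with e <? i
    ... | yes _ = a i
    ... | no  _ = 0#

  ν∞≡ : Laurent → ℤ → Set ℓ
  ν∞≡ L w = ¬ (coeff L w ≈ 0#) × (∀ z → w ℤ.< z → coeff L z ≈ 0#)

  -- L ∈ \overline{k((X^{-1}))}, i.e. ν∞(L) < 0: no terms X^z with z ≥ 0
  InOverline : Laurent → Set ℓ
  InOverline L = ∀ (z : ℕ) → coeff L (+ z) ≈ 0#

  -- φ = [0; A 1, A 2, A 3, ...]: φ = 1/(A_1 + φ_1), φ_1 = 1/(A_2 + φ_2), ...
  -- with all complete-quotient tails φ_i in \overline{k((X^{-1}))}.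
  IsCF : (ℕ → Laurent) → Laurent → Set (c ⊔ ℓ)
  IsCF A φ = Σ (ℕ → Laurent) λ θ →
      (θ 0 ≋ φ)
    × (∀ i → InOverline (θ i))
    × (∀ i → (θ i *L (A (suc i) +L θ (suc i))) ≋ 1L)

  -- Fibonacci polynomials: (F_{n-1}, F_n) with F_{-1} = 0, F_0 = 1,
  -- F_n = A_n F_{n-1} + F_{n-2}.
  fibPair : (ℕ → Laurent) → ℕ → Laurent × Laurent
  fibPair A zero    = 0L , 1L
  fibPair A (suc n) with fibPair A n
  ... | p , q = q , ((A (suc n) *L q) +L p)

  Fib : (ℕ → Laurent) → ℕ → Laurent
  Fib A n = proj₂ (fibPair A n)

  zeck : (ℕ → Laurent) → (ℕ → Carrier) → ℕ → Laurent
  zeck A z zero    = constL (z 0) *L Fib A 0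
  zeck A z (suc r) = zeck A z r +L (constL (z (suc r)) *L Fib A (suc r))

{-# OPTIONS --safe #-}
-- Let θ 0 = φ, θ 1, θ 2, … be the complete quotients, so θ i (A (i+1) + θ (i+1)) = 1; comparing
-- constant terms gives ν∞(θ i) = -1. The remainders ε (-1) = -1, ε 0 = φ and
-- ε (n+1) = A (n+1) ε n + ε (n-1) satisfy ε n = -θ n ε (n-1), hence ν∞(ε n) = -n-1. Since F n φ - ε n
-- satisfies the Fibonacci recurrence with initial values 1 and 0, it is a polynomial, so the
-- fractional part of n(X) φ is Σ z i ε i, whose term of largest degree is z j ε j.
module Submission where

open import Defs
open import Data.Nat using (ℕ; suc; _≤_; _<_)
open import Data.Integer using (-[1+_])
open import Relation.Nullary using (¬_)

open import Algebra.Bundles using (CommutativeRing)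
open import Data.Empty using (⊥-elim)
open import Data.Integer as ℤ using (ℤ; +_)
import Data.Integer.Properties as ℤP
open import Data.Integer.Tactic.RingSolver using (solve-∀)
open import Data.Nat as ℕ using (zero; _∸_; _<?_; z≤n; s≤s)
import Data.Nat.Properties as ℕP
open import Data.Product using (∃; _×_; _,_; proj₁; proj₂)
open import Data.Sum using (_⊎_; inj₁; inj₂)
open import Relation.Binary using (tri<; tri≈; tri>)
open import Function using (_∘_)
open import Relation.Binary.PropositionalEquality as P using (_≡_; _≢_)
open import Relation.Nullary using (yes; no)

m-[m-n]≡n : ∀ (m n : ℤ) → m ℤ.- (m ℤ.- n) ≡ n
m-[m-n]≡n = solve-∀

[m-n]+[p-q]≡[m+p]-[n+q] : ∀ (m n p q : ℤ) → (m ℤ.- n) ℤ.+ (p ℤ.- q) ≡ (m ℤ.+ p) ℤ.- (n ℤ.+ q)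
[m-n]+[p-q]≡[m+p]-[n+q] = solve-∀

m-[1+m]≡-1 : ∀ (m : ℤ) → m ℤ.- (+ 1 ℤ.+ m) ≡ ℤ.- (+ 1)
m-[1+m]≡-1 = solve-∀

[m+n]-n≡m : ∀ (m n : ℤ) → (m ℤ.+ n) ℤ.- n ≡ m
[m+n]-n≡m = solve-∀

module Sequences {c ℓ} (R : CommutativeRing c ℓ) where
  open CommutativeRing R
  open LaurentSeries R using (shiftSeq; sumTo)
  open import Relation.Binary.Reasoning.Setoid setoid
  open import Algebra.Properties.CommutativeSemigroup +-commutativeSemigroup using (interchange)

  Seq : Set c
  Seq = ℕ → Carrier

  infix 4 _≐_
  _≐_ : Seq → Seq → Set ℓ
  a ≐ b = ∀ i → a i ≈ b i

  VanishesBelow : ℕ → Seq → Set ℓ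
  VanishesBelow p a = ∀ i → i < p → a i ≈ 0#

  VanishesAfter : ℕ → Seq → Set ℓ
  VanishesAfter e a = ∀ i → e < i → a i ≈ 0#

  conv : Seq → Seq → Seq
  conv a b n = sumTo n (λ k → a k * b (n ∸ k))

  sumTo-cong-≤ : ∀ n {f g : Seq} → (∀ i → i ≤ n → f i ≈ g i) → sumTo n f ≈ sumTo n g
  sumTo-cong-≤ zero    f≈g = f≈g 0 z≤n
  sumTo-cong-≤ (suc n) f≈g =
    +-cong (sumTo-cong-≤ n (λ i i≤n → f≈g i (ℕP.m≤n⇒m≤1+n i≤n))) (f≈g (suc n) ℕP.≤-refl)

  sumTo-cong : ∀ n {f g : Seq} → f ≐ g → sumTo n f ≈ sumTo n g
  sumTo-cong n f≈g = sumTo-cong-≤ n (λ i _ → f≈g i)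

  sumTo-+ : ∀ n (f g : Seq) → sumTo n (λ i → f i + g i) ≈ sumTo n f + sumTo n g
  sumTo-+ zero    f g = refl
  sumTo-+ (suc n) f g = trans (+-congʳ (sumTo-+ n f g)) (interchange _ _ _ _)

  sumTo-*ˡ : ∀ n x (f : Seq) → sumTo n (λ i → x * f i) ≈ x * sumTo n f
  sumTo-*ˡ zero    x f = refl
  sumTo-*ˡ (suc n) x f = trans (+-congʳ (sumTo-*ˡ n x f)) (sym (distribˡ x _ _))

  sumTo-zero : ∀ n (f : Seq) → (∀ i → i ≤ n → f i ≈ 0#) → sumTo n f ≈ 0#
  sumTo-zero n f f≈0 = trans (sumTo-cong-≤ n f≈0) (sumTo-const0 n)
    where
    sumTo-const0 : ∀ n → sumTo n (λ _ → 0#) ≈ 0#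
    sumTo-const0 zero    = refl
    sumTo-const0 (suc n) = trans (+-congʳ (sumTo-const0 n)) (+-identityˡ 0#)

  sumTo-single : ∀ r j (f : Seq) → j ≤ r → (∀ i → i ≤ r → i ≢ j → f i ≈ 0#) → sumTo r f ≈ f j
  sumTo-single zero    zero f _ _ = refl
  sumTo-single (suc r) j f j≤1+r others with j ℕ.≟ suc r
  ... | yes P.refl = begin
    sumTo r f + f (suc r) ≈⟨ +-congʳ (sumTo-zero r f (λ i i≤r →
                               others i (ℕP.m≤n⇒m≤1+n i≤r) (ℕP.<⇒≢ (s≤s i≤r)))) ⟩
    0# + f (suc r)        ≈⟨ +-identityˡ _ ⟩
    f (suc r)             ∎
  ... | no j≢1+r = begin
    sumTo r f + f (suc r) ≈⟨ +-cong (sumTo-single r j f (ℕ.s≤s⁻¹ (ℕP.≤∧≢⇒< j≤1+r j≢1+r))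
                                       (λ i i≤r → others i (ℕP.m≤n⇒m≤1+n i≤r)))
                                    (others (suc r) ℕP.≤-refl (j≢1+r ∘ P.sym)) ⟩
    f j + 0#              ≈⟨ +-identityʳ _ ⟩
    f j                   ∎

  sumTo-unfoldˡ : ∀ n (f : Seq) → sumTo (suc n) f ≈ f 0 + sumTo n (λ i → f (suc i))
  sumTo-unfoldˡ zero    f = refl
  sumTo-unfoldˡ (suc n) f = trans (+-congʳ (sumTo-unfoldˡ n f)) (+-assoc _ _ _)

  sumTo-reverse : ∀ n (f : Seq) → sumTo n f ≈ sumTo n (λ k → f (n ∸ k))
  sumTo-reverse zero    f = refl
  sumTo-reverse (suc n) f = begin
    sumTo n f + f (suc n)                 ≈⟨ +-comm _ _ ⟩
    f (suc n) + sumTo n f                 ≈⟨ +-congˡ (sumTo-reverse n f) ⟩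
    f (suc n) + sumTo n (λ k → f (n ∸ k)) ≈⟨ sumTo-unfoldˡ n (λ k → f (suc n ∸ k)) ⟨
    sumTo (suc n) (λ k → f (suc n ∸ k))   ∎

  conv-cong : ∀ {a a′ b b′} → a ≐ a′ → b ≐ b′ → conv a b ≐ conv a′ b′
  conv-cong a≐a′ b≐b′ n = sumTo-cong n (λ k → *-cong (a≐a′ k) (b≐b′ (n ∸ k)))

  conv-comm : ∀ a b → conv a b ≐ conv b a
  conv-comm a b n = begin
    sumTo n (λ k → a k * b (n ∸ k))               ≈⟨ sumTo-reverse n _ ⟩
    sumTo n (λ k → a (n ∸ k) * b (n ∸ (n ∸ k)))   ≈⟨ sumTo-cong-≤ n (λ k k≤n →
      trans (*-comm _ _) (reflexive (P.cong (λ t → b t * a (n ∸ k)) (ℕP.m∸[m∸n]≡n k≤n)))) ⟩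
    sumTo n (λ k → b k * a (n ∸ k))               ∎

  conv-unfoldˡ : ∀ a b n → conv a b (suc n) ≈ a 0 * b (suc n) + conv (λ i → a (suc i)) b n
  conv-unfoldˡ a b n = sumTo-unfoldˡ n _

  conv-distribʳ-+ : ∀ a a′ b → conv (λ i → a i + a′ i) b ≐ (λ n → conv a b n + conv a′ b n)
  conv-distribʳ-+ a a′ b n = trans (sumTo-cong n (λ k → distribʳ _ _ _)) (sumTo-+ n _ _)

  conv-*ˡ : ∀ x a b → conv (λ i → x * a i) b ≐ (λ n → x * conv a b n)
  conv-*ˡ x a b n = trans (sumTo-cong n (λ k → *-assoc _ _ _)) (sumTo-*ˡ n x _)

  conv-constˡ : ∀ x d b → d 0 ≈ x → (∀ i → d (suc i) ≈ 0#) → conv d b ≐ (λ n → x * b n)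
  conv-constˡ x d b d₀≈x _      zero    = *-congʳ d₀≈x
  conv-constˡ x d b d₀≈x d₊≈0 (suc n) = begin
    conv d b (suc n)                                 ≈⟨ conv-unfoldˡ d b n ⟩
    d 0 * b (suc n) + conv (λ i → d (suc i)) b n     ≈⟨ +-cong (*-congʳ d₀≈x) (sumTo-zero n _ d₊b≈0) ⟩
    x * b (suc n) + 0#                               ≈⟨ +-identityʳ _ ⟩
    x * b (suc n)                                    ∎
    where
    d₊b≈0 : ∀ k → k ≤ n → d (suc k) * b (n ∸ k) ≈ 0#
    d₊b≈0 k _ = trans (*-congʳ (d₊≈0 k)) (zeroˡ _)

  conv-assoc : ∀ n a b d → conv (conv a b) d n ≈ conv a (conv b d) n
  conv-assoc zero    a b d = *-assoc _ _ _
  conv-assoc (suc n) a b d = begin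
    conv (conv a b) d (suc n)
      ≈⟨ conv-unfoldˡ (conv a b) d n ⟩
    (a 0 * b 0) * d (suc n) + conv (λ i → conv a b (suc i)) d n
      ≈⟨ +-congˡ (conv-cong {b = d} (conv-unfoldˡ a b) (λ _ → refl) n) ⟩
    (a 0 * b 0) * d (suc n) + conv (λ i → a 0 * b (suc i) + conv a₊ b i) d n
      ≈⟨ +-congˡ (conv-distribʳ-+ (λ i → a 0 * b (suc i)) (conv a₊ b) d n) ⟩
    (a 0 * b 0) * d (suc n) + (conv (λ i → a 0 * b (suc i)) d n + conv (conv a₊ b) d n)
      ≈⟨ +-congˡ (+-cong (conv-*ˡ (a 0) b₊ d n) (conv-assoc n a₊ b d)) ⟩
    (a 0 * b 0) * d (suc n) + (a 0 * conv b₊ d n + conv a₊ (conv b d) n)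
      ≈⟨ +-assoc _ _ _ ⟨
    ((a 0 * b 0) * d (suc n) + a 0 * conv b₊ d n) + conv a₊ (conv b d) n
      ≈⟨ +-congʳ (trans (+-congʳ (*-assoc _ _ _)) (sym (distribˡ _ _ _))) ⟩
    a 0 * (b 0 * d (suc n) + conv b₊ d n) + conv a₊ (conv b d) n
      ≈⟨ +-congʳ (*-congˡ (conv-unfoldˡ b d n)) ⟨
    a 0 * conv b d (suc n) + conv a₊ (conv b d) n
      ≈⟨ conv-unfoldˡ a (conv b d) n ⟨
    conv a (conv b d) (suc n) ∎
    where
    a₊ b₊ : Seq
    a₊ i = a (suc i)
    b₊ i = b (suc i)

  shiftSeq-cong : ∀ k {a b} → a ≐ b → shiftSeq k a ≐ shiftSeq k b
  shiftSeq-cong zero    a≐b i       = a≐b i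
  shiftSeq-cong (suc k) a≐b zero    = refl
  shiftSeq-cong (suc k) a≐b (suc i) = shiftSeq-cong k a≐b i

  shiftSeq-shiftSeq : ∀ j k a → shiftSeq j (shiftSeq k a) ≐ shiftSeq (j ℕ.+ k) a
  shiftSeq-shiftSeq zero    k a i       = refl
  shiftSeq-shiftSeq (suc j) k a zero    = refl
  shiftSeq-shiftSeq (suc j) k a (suc i) = shiftSeq-shiftSeq j k a i

  shiftSeq-vanishesBelow : ∀ k a → VanishesBelow k (shiftSeq k a)
  shiftSeq-vanishesBelow (suc k) a zero    _           = refl
  shiftSeq-vanishesBelow (suc k) a (suc i) (s≤s i<k) = shiftSeq-vanishesBelow k a i i<k

  shiftSeq-at : ∀ k a → shiftSeq k a k ≡ a 0
  shiftSeq-at zero    a = P.refl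
  shiftSeq-at (suc k) a = shiftSeq-at k a

  vanishesBelow⇒shiftSeq : ∀ p a → VanishesBelow p a → a ≐ shiftSeq p (λ i → a (p ℕ.+ i))
  vanishesBelow⇒shiftSeq zero    a _   i       = refl
  vanishesBelow⇒shiftSeq (suc p) a a<p zero    = a<p 0 (s≤s z≤n)
  vanishesBelow⇒shiftSeq (suc p) a a<p (suc i) =
    vanishesBelow⇒shiftSeq p (λ i → a (suc i)) (λ i i<p → a<p (suc i) (s≤s i<p)) i

  conv-shiftSeqˡ : ∀ k a b → shiftSeq k (conv a b) ≐ conv (shiftSeq k a) b
  conv-shiftSeqˡ zero    a b i       = refl
  conv-shiftSeqˡ (suc k) a b zero    = sym (zeroˡ _)
  conv-shiftSeqˡ (suc k) a b (suc i) = begin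
    shiftSeq k (conv a b) i                                 ≈⟨ conv-shiftSeqˡ k a b i ⟩
    conv (shiftSeq k a) b i                                 ≈⟨ +-identityˡ _ ⟨
    0# + conv (shiftSeq k a) b i                            ≈⟨ +-congʳ (zeroˡ _) ⟨
    0# * b (suc i) + conv (shiftSeq k a) b i                ≈⟨ conv-unfoldˡ (shiftSeq (suc k) a) b i ⟨
    conv (shiftSeq (suc k) a) b (suc i)                     ∎

  -- a and b are the shifts by p and q of a′ and b′, so conv a b is the shift by p + q of conv b′ a′.
  conv-vanishesBelow : ∀ p q a b → VanishesBelow p a → VanishesBelow q b →
    VanishesBelow (p ℕ.+ q) (conv a b) × conv a b (p ℕ.+ q) ≈ a p * b q
  conv-vanishesBelow p q a b a<p b<q =
    (λ i i<p+q → trans (conv≐shift i) (shiftSeq-vanishesBelow (p ℕ.+ q) _ i i<p+q)) ,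
    (begin
      conv a b (p ℕ.+ q)                             ≈⟨ conv≐shift (p ℕ.+ q) ⟩
      shiftSeq (p ℕ.+ q) (conv b′ a′) (p ℕ.+ q)      ≡⟨ shiftSeq-at (p ℕ.+ q) (conv b′ a′) ⟩
      b′ 0 * a′ 0                                    ≈⟨ *-comm _ _ ⟩
      a′ 0 * b′ 0                                    ≡⟨ P.cong₂ (λ i j → a i * b j) (ℕP.+-identityʳ p)
                                                                                   (ℕP.+-identityʳ q) ⟩
      a p * b q                                      ∎)
    where
    a′ b′ : Seq
    a′ i = a (p ℕ.+ i)
    b′ i = b (q ℕ.+ i)
    conv≐shift : conv a b ≐ shiftSeq (p ℕ.+ q) (conv b′ a′)
    conv≐shift n = begin
      conv a b n
        ≈⟨ conv-cong (vanishesBelow⇒shiftSeq p a a<p) (vanishesBelow⇒shiftSeq q b b<q) n ⟩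
      conv (shiftSeq p a′) (shiftSeq q b′) n
        ≈⟨ conv-shiftSeqˡ p a′ (shiftSeq q b′) n ⟨
      shiftSeq p (conv a′ (shiftSeq q b′)) n
        ≈⟨ shiftSeq-cong p (λ i → trans (conv-comm a′ _ i) (sym (conv-shiftSeqˡ q b′ a′ i))) n ⟩
      shiftSeq p (shiftSeq q (conv b′ a′)) n
        ≈⟨ shiftSeq-shiftSeq p q _ n ⟩
      shiftSeq (p ℕ.+ q) (conv b′ a′) n ∎

  conv-vanishesAfter : ∀ e f a b → VanishesAfter e a → VanishesAfter f b → VanishesAfter (e ℕ.+ f) (conv a b)
  conv-vanishesAfter e f a b a>e b>f n e+f<n = sumTo-zero n _ term≈0
    where
    term≈0 : ∀ k → k ≤ n → a k * b (n ∸ k) ≈ 0#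
    term≈0 k k≤n with e <? k
    ... | yes e<k = trans (*-congʳ (a>e k e<k)) (zeroˡ _)
    ... | no  e≮k = trans (*-congˡ (b>f (n ∸ k) f<n∸k)) (zeroʳ _)
      where
      f<n∸k : f < n ∸ k
      f<n∸k = ℕP.<-≤-trans (ℕP.m+n≤o⇒m≤o∸n (suc f) (P.subst (ℕ._≤ n) (P.cong suc (ℕP.+-comm e f)) e+f<n))
                           (ℕP.∸-monoʳ-≤ n (ℕP.≮⇒≥ e≮k))

module LaurentRing {c ℓ} (R : CommutativeRing c ℓ) where
  open CommutativeRing R
  open LaurentSeries R
  open Sequences R
  open import Relation.Binary.Reasoning.Setoid setoid
  open import Algebra.Properties.Ring ring using (-0#≈0#)

  seqAt : Seq → ℤ → Carrier
  seqAt a (+ i)    = a i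
  seqAt a -[1+ _ ] = 0#

  coeff-mkL : ∀ e a z → coeff (mkL e a) z ≡ seqAt a (+ e ℤ.- z)
  coeff-mkL e a z with (+ e) ℤ.- z
  ... | + i      = P.refl
  ... | -[1+ _ ] = P.refl

  coeff-mkL-at : ∀ e a i → coeff (mkL e a) (+ e ℤ.- + i) ≡ a i
  coeff-mkL-at e a i = P.trans (coeff-mkL e a (+ e ℤ.- + i)) (P.cong (seqAt a) (m-[m-n]≡n (+ e) (+ i)))

  seqAt-cong : ∀ {a b} → a ≐ b → ∀ w → seqAt a w ≈ seqAt b w
  seqAt-cong a≐b (+ i)    = a≐b i
  seqAt-cong a≐b -[1+ _ ] = refl

  seqAt-+ : ∀ a b w → seqAt (λ i → a i + b i) w ≈ seqAt a w + seqAt b w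
  seqAt-+ a b (+ i)    = refl
  seqAt-+ a b -[1+ _ ] = sym (+-identityˡ 0#)

  seqAt-neg : ∀ a w → seqAt (λ i → - a i) w ≈ - seqAt a w
  seqAt-neg a (+ i)    = refl
  seqAt-neg a -[1+ _ ] = sym -0#≈0#

  seqAt-*ˡ : ∀ x a w → seqAt (λ i → x * a i) w ≈ x * seqAt a w
  seqAt-*ˡ x a (+ i)    = refl
  seqAt-*ˡ x a -[1+ _ ] = sym (zeroʳ x)

  seqAt-shiftSeq : ∀ k a w → seqAt (shiftSeq k a) (+ k ℤ.+ w) ≈ seqAt a w
  seqAt-shiftSeq zero    a w = reflexive (P.cong (seqAt a) (ℤP.+-identityˡ w))
  seqAt-shiftSeq (suc k) a w = begin
    seqAt (shiftSeq (suc k) a) (+ suc k ℤ.+ w)      ≡⟨ P.cong (seqAt (shiftSeq (suc k) a)) (ℤP.+-assoc (+ 1) (+ k) w) ⟩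
    seqAt (shiftSeq (suc k) a) (ℤ.suc (+ k ℤ.+ w))  ≈⟨ seqAt-suc (+ k ℤ.+ w) ⟩
    seqAt (shiftSeq k a) (+ k ℤ.+ w)                ≈⟨ seqAt-shiftSeq k a w ⟩
    seqAt a w                                       ∎
    where
    seqAt-suc : ∀ w → seqAt (shiftSeq (suc k) a) (ℤ.suc w) ≈ seqAt (shiftSeq k a) w
    seqAt-suc (+ i)          = refl
    seqAt-suc -[1+ zero ]    = refl
    seqAt-suc -[1+ suc _ ]   = refl

  coeff-raise : ∀ k e a z → coeff (mkL (k ℕ.+ e) (shiftSeq k a)) z ≈ coeff (mkL e a) z
  coeff-raise k e a z = begin
    coeff (mkL (k ℕ.+ e) (shiftSeq k a)) z           ≡⟨ coeff-mkL (k ℕ.+ e) (shiftSeq k a) z ⟩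
    seqAt (shiftSeq k a) (+ (k ℕ.+ e) ℤ.- z)         ≡⟨ P.cong (seqAt (shiftSeq k a)) (ℤP.+-assoc (+ k) (+ e) (ℤ.- z)) ⟩
    seqAt (shiftSeq k a) (+ k ℤ.+ (+ e ℤ.- z))       ≈⟨ seqAt-shiftSeq k a (+ e ℤ.- z) ⟩
    seqAt a (+ e ℤ.- z)                              ≡⟨ coeff-mkL e a z ⟨
    coeff (mkL e a) z                                ∎

  ≋-refl : ∀ {L} → L ≋ L
  ≋-refl z = refl

  ≋-sym : ∀ {L M} → L ≋ M → M ≋ L
  ≋-sym L≋M z = sym (L≋M z)

  ≋-trans : ∀ {L M N} → L ≋ M → M ≋ N → L ≋ N
  ≋-trans L≋M M≋N z = trans (L≋M z) (M≋N z)

  mkL-cong : ∀ {e f a b} → e ≡ f → a ≐ b → mkL e a ≋ mkL f b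
  mkL-cong {e} {a = a} {b} P.refl a≐b z = begin
    coeff (mkL e a) z     ≡⟨ coeff-mkL e a z ⟩
    seqAt a (+ e ℤ.- z)   ≈⟨ seqAt-cong a≐b (+ e ℤ.- z) ⟩
    seqAt b (+ e ℤ.- z)   ≡⟨ coeff-mkL e b z ⟨
    coeff (mkL e b) z     ∎

  ≋⇒shiftSeq≐ : ∀ {e f a b} → mkL e a ≋ mkL f b → shiftSeq f a ≐ shiftSeq e b
  ≋⇒shiftSeq≐ {e} {f} {a} {b} L≋M i = begin
    shiftSeq f a i                            ≡⟨ coeff-mkL-at (f ℕ.+ e) (shiftSeq f a) i ⟨
    coeff (mkL (f ℕ.+ e) (shiftSeq f a)) z    ≈⟨ coeff-raise f e a z ⟩
    coeff (mkL e a) z                         ≈⟨ L≋M z ⟩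
    coeff (mkL f b) z                         ≈⟨ coeff-raise e f b z ⟨
    coeff (mkL (e ℕ.+ f) (shiftSeq e b)) z    ≡⟨ P.cong (λ t → coeff (mkL t (shiftSeq e b)) z) (ℕP.+-comm e f) ⟩
    coeff (mkL (f ℕ.+ e) (shiftSeq e b)) z    ≡⟨ coeff-mkL-at (f ℕ.+ e) (shiftSeq e b) i ⟩
    shiftSeq e b i                            ∎
    where
    z = + (f ℕ.+ e) ℤ.- + i

  negL : Laurent → Laurent
  negL (mkL e a) = mkL e (λ i → - a i)

  coeff-+L : ∀ L M z → coeff (L +L M) z ≈ coeff L z + coeff M z
  coeff-+L (mkL e a) (mkL f b) z = begin
    coeff (mkL (e ℕ.+ f) (λ i → shiftSeq f a i + shiftSeq e b i)) z
      ≡⟨ coeff-mkL (e ℕ.+ f) _ z ⟩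
    seqAt (λ i → shiftSeq f a i + shiftSeq e b i) (+ (e ℕ.+ f) ℤ.- z)
      ≈⟨ seqAt-+ (shiftSeq f a) (shiftSeq e b) (+ (e ℕ.+ f) ℤ.- z) ⟩
    seqAt (shiftSeq f a) (+ (e ℕ.+ f) ℤ.- z) + seqAt (shiftSeq e b) (+ (e ℕ.+ f) ℤ.- z)
      ≡⟨ P.cong₂ _+_ (P.trans (P.cong (λ t → seqAt (shiftSeq f a) (+ t ℤ.- z)) (ℕP.+-comm e f))
                              (P.sym (coeff-mkL (f ℕ.+ e) (shiftSeq f a) z)))
                     (P.sym (coeff-mkL (e ℕ.+ f) (shiftSeq e b) z)) ⟩
    coeff (mkL (f ℕ.+ e) (shiftSeq f a)) z + coeff (mkL (e ℕ.+ f) (shiftSeq e b)) z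
      ≈⟨ +-cong (coeff-raise f e a z) (coeff-raise e f b z) ⟩
    coeff (mkL e a) z + coeff (mkL f b) z ∎

  coeff-negL : ∀ L z → coeff (negL L) z ≈ - coeff L z
  coeff-negL (mkL e a) z = begin
    coeff (mkL e (λ i → - a i)) z  ≡⟨ coeff-mkL e _ z ⟩
    seqAt (λ i → - a i) (+ e ℤ.- z) ≈⟨ seqAt-neg a (+ e ℤ.- z) ⟩
    - seqAt a (+ e ℤ.- z)           ≡⟨ P.cong -_ (coeff-mkL e a z) ⟨
    - coeff (mkL e a) z             ∎

  coeff-0L : ∀ z → coeff 0L z ≈ 0#
  coeff-0L z = trans (reflexive (coeff-mkL 0 _ z)) (seqAt-0 (+ 0 ℤ.- z))
    where
    seqAt-0 : ∀ w → seqAt (λ _ → 0#) w ≈ 0#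
    seqAt-0 (+ _)    = refl
    seqAt-0 -[1+ _ ] = refl

  coeff-constL-*L : ∀ x L z → coeff (constL x *L L) z ≈ x * coeff L z
  coeff-constL-*L x (mkL e a) z = begin
    coeff (constL x *L mkL e a) z               ≡⟨ coeff-mkL e _ z ⟩
    seqAt (conv (co (constL x)) a) (+ e ℤ.- z)  ≈⟨ seqAt-cong (conv-constˡ x _ a refl (λ _ → refl)) (+ e ℤ.- z) ⟩
    seqAt (λ i → x * a i) (+ e ℤ.- z)           ≈⟨ seqAt-*ˡ x a (+ e ℤ.- z) ⟩
    x * seqAt a (+ e ℤ.- z)                     ≡⟨ P.cong (x *_) (coeff-mkL e a z) ⟨
    x * coeff (mkL e a) z                       ∎

  +L-cong : ∀ {L L′ M M′} → L ≋ L′ → M ≋ M′ → (L +L M) ≋ (L′ +L M′)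
  +L-cong {L} {L′} {M} {M′} L≋L′ M≋M′ z =
    trans (coeff-+L L M z) (trans (+-cong (L≋L′ z) (M≋M′ z)) (sym (coeff-+L L′ M′ z)))

  +L-assoc : ∀ L M N → ((L +L M) +L N) ≋ (L +L (M +L N))
  +L-assoc L M N z = begin
    coeff ((L +L M) +L N) z               ≈⟨ coeff-+L (L +L M) N z ⟩
    coeff (L +L M) z + coeff N z          ≈⟨ +-congʳ (coeff-+L L M z) ⟩
    (coeff L z + coeff M z) + coeff N z   ≈⟨ +-assoc _ _ _ ⟩
    coeff L z + (coeff M z + coeff N z)   ≈⟨ +-congˡ (coeff-+L M N z) ⟨
    coeff L z + coeff (M +L N) z          ≈⟨ coeff-+L L (M +L N) z ⟨
    coeff (L +L (M +L N)) z               ∎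

  +L-comm : ∀ L M → (L +L M) ≋ (M +L L)
  +L-comm L M z = trans (coeff-+L L M z) (trans (+-comm _ _) (sym (coeff-+L M L z)))

  +L-identityˡ : ∀ L → (0L +L L) ≋ L
  +L-identityˡ L z = trans (coeff-+L 0L L z) (trans (+-congʳ (coeff-0L z)) (+-identityˡ _))

  +L-identityʳ : ∀ L → (L +L 0L) ≋ L
  +L-identityʳ L = ≋-trans (+L-comm L 0L) (+L-identityˡ L)

  negL-inverseˡ : ∀ L → (negL L +L L) ≋ 0L
  negL-inverseˡ L z = begin
    coeff (negL L +L L) z            ≈⟨ coeff-+L (negL L) L z ⟩
    coeff (negL L) z + coeff L z     ≈⟨ +-congʳ (coeff-negL L z) ⟩
    - coeff L z + coeff L z          ≈⟨ -‿inverseˡ _ ⟩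
    0#                               ≈⟨ coeff-0L z ⟨
    coeff 0L z                       ∎

  negL-inverseʳ : ∀ L → (L +L negL L) ≋ 0L
  negL-inverseʳ L = ≋-trans (+L-comm L (negL L)) (negL-inverseˡ L)

  negL-cong : ∀ {L M} → L ≋ M → negL L ≋ negL M
  negL-cong {L} {M} L≋M z = trans (coeff-negL L z) (trans (-‿cong (L≋M z)) (sym (coeff-negL M z)))

  *L-assoc : ∀ L M N → ((L *L M) *L N) ≋ (L *L (M *L N))
  *L-assoc (mkL e a) (mkL f b) (mkL g d) = mkL-cong (ℕP.+-assoc e f g) (λ n → conv-assoc n a b d)

  *L-comm : ∀ L M → (L *L M) ≋ (M *L L)
  *L-comm (mkL e a) (mkL f b) = mkL-cong (ℕP.+-comm e f) (conv-comm a b)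

  *L-identityˡ : ∀ L → (1L *L L) ≋ L
  *L-identityˡ (mkL e a) =
    mkL-cong P.refl (λ n → trans (conv-constˡ 1# _ a refl (λ _ → refl) n) (*-identityˡ _))

  *L-identityʳ : ∀ L → (L *L 1L) ≋ L
  *L-identityʳ L = ≋-trans (*L-comm L 1L) (*L-identityˡ L)

  *L-congʳ : ∀ {L L′} M → L ≋ L′ → (L *L M) ≋ (L′ *L M)
  *L-congʳ {mkL e a} {mkL e′ a′} (mkL f b) L≋L′ =
    ≋-trans (≋-sym (coeff-raise e′ (e ℕ.+ f) (conv a b)))
    (≋-trans (mkL-cong tops≡ shifts≐)
             (coeff-raise e (e′ ℕ.+ f) (conv a′ b)))
    where
    tops≡ : e′ ℕ.+ (e ℕ.+ f) ≡ e ℕ.+ (e′ ℕ.+ f)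
    tops≡ = P.trans (P.sym (ℕP.+-assoc e′ e f)) (P.trans (P.cong (ℕ._+ f) (ℕP.+-comm e′ e)) (ℕP.+-assoc e e′ f))
    shifts≐ : shiftSeq e′ (conv a b) ≐ shiftSeq e (conv a′ b)
    shifts≐ i = begin
      shiftSeq e′ (conv a b) i       ≈⟨ conv-shiftSeqˡ e′ a b i ⟩
      conv (shiftSeq e′ a) b i       ≈⟨ conv-cong {b = b} (≋⇒shiftSeq≐ L≋L′) (λ _ → refl) i ⟩
      conv (shiftSeq e a′) b i       ≈⟨ conv-shiftSeqˡ e a′ b i ⟨
      shiftSeq e (conv a′ b) i       ∎

  *L-cong : ∀ {L L′ M M′} → L ≋ L′ → M ≋ M′ → (L *L M) ≋ (L′ *L M′)
  *L-cong {L} {L′} {M} {M′} L≋L′ M≋M′ =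
    ≋-trans (*L-congʳ M L≋L′) (≋-trans (*L-comm L′ M) (≋-trans (*L-congʳ L′ M≋M′) (*L-comm M′ L′)))

  *L-distribˡ-+L : ∀ L M N → (L *L (M +L N)) ≋ ((L *L M) +L (L *L N))
  *L-distribˡ-+L (mkL e a) (mkL f b) (mkL g d) z = sym (begin
    coeff ((L *L M) +L (L *L N)) z
      ≈⟨ coeff-+L (L *L M) (L *L N) z ⟩
    coeff (L *L M) z + coeff (L *L N) z
      ≈⟨ +-cong (*L-cong {L} (≋-refl {L}) M≋M⁺ z) (*L-cong {L} (≋-refl {L}) N≋N⁺ z) ⟩
    coeff (L *L M⁺) z + coeff (L *L N⁺) z
      ≡⟨ P.cong₂ _+_ (coeff-mkL T _ z) (coeff-mkL T _ z) ⟩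
    seqAt (conv a (shiftSeq g b)) (+ T ℤ.- z) + seqAt (conv a (shiftSeq f d)) (+ T ℤ.- z)
      ≈⟨ seqAt-+ (conv a (shiftSeq g b)) _ (+ T ℤ.- z) ⟨
    seqAt (λ i → conv a (shiftSeq g b) i + conv a (shiftSeq f d) i) (+ T ℤ.- z)
      ≈⟨ seqAt-cong (λ i → sym (conv-distribˡ i)) (+ T ℤ.- z) ⟩
    seqAt (conv a b+d) (+ T ℤ.- z)
      ≡⟨ coeff-mkL T _ z ⟨
    coeff (L *L (M +L N)) z ∎)
    where
    L = mkL e a
    M = mkL f b
    N = mkL g d
    T = e ℕ.+ (f ℕ.+ g)
    M⁺ = mkL (f ℕ.+ g) (shiftSeq g b)
    N⁺ = mkL (f ℕ.+ g) (shiftSeq f d)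
    M≋M⁺ : M ≋ M⁺
    M≋M⁺ = ≋-sym (≋-trans (mkL-cong (ℕP.+-comm f g) (λ _ → refl)) (coeff-raise g f b))
    N≋N⁺ : N ≋ N⁺
    N≋N⁺ = ≋-sym (coeff-raise f g d)
    b+d : Seq
    b+d i = shiftSeq g b i + shiftSeq f d i
    conv-distribˡ : ∀ i → conv a b+d i ≈ conv a (shiftSeq g b) i + conv a (shiftSeq f d) i
    conv-distribˡ i = begin
      conv a b+d i                                        ≈⟨ conv-comm a b+d i ⟩
      conv b+d a i                                        ≈⟨ conv-distribʳ-+ (shiftSeq g b) (shiftSeq f d) a i ⟩
      conv (shiftSeq g b) a i + conv (shiftSeq f d) a i   ≈⟨ +-cong (conv-comm _ a i) (conv-comm _ a i) ⟩
      conv a (shiftSeq g b) i + conv a (shiftSeq f d) i   ∎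

  *L-distribʳ-+L : ∀ L M N → ((M +L N) *L L) ≋ ((M *L L) +L (N *L L))
  *L-distribʳ-+L L M N =
    ≋-trans (*L-comm (M +L N) L) (≋-trans (*L-distribˡ-+L L M N) (+L-cong (*L-comm L M) (*L-comm L N)))

  -- _≋_ unfolds to a function type, from which Agda cannot recover the two series;
  -- the wrapper makes them inferable in the implicit arguments of the ring laws.
  infix 4 _≈ᴸ_
  record _≈ᴸ_ (L M : Laurent) : Set ℓ where
    constructor wrap
    field unwrap : L ≋ M
  open _≈ᴸ_ public

  laurentRing : CommutativeRing c ℓ
  laurentRing = record
    { Carrier = Laurent ; _≈_ = _≈ᴸ_ ; _+_ = _+L_ ; _*_ = _*L_ ; -_ = negL ; 0# = 0L ; 1# = 1L
    ; isCommutativeRing = record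
      { isRing = record
        { +-isAbelianGroup = record
          { isGroup = record
            { isMonoid = record
              { isSemigroup = record
                { isMagma = record
                  { isEquivalence = record
                    { refl  = λ {L} → wrap (≋-refl {L})
                    ; sym   = λ {L} {M} L≈M → wrap (≋-sym {L} {M} (unwrap L≈M))
                    ; trans = λ {L} {M} {N} L≈M M≈N → wrap (≋-trans {L} {M} {N} (unwrap L≈M) (unwrap M≈N)) }
                  ; ∙-cong = λ {L} {L′} {M} {M′} L≈L′ M≈M′ →
                      wrap (+L-cong {L} {L′} {M} {M′} (unwrap L≈L′) (unwrap M≈M′)) }
                ; assoc = λ L M N → wrap (+L-assoc L M N) }
              ; identity = (λ L → wrap (+L-identityˡ L)) , (λ L → wrap (+L-identityʳ L)) }
            ; inverse = (λ L → wrap (negL-inverseˡ L)) , (λ L → wrap (negL-inverseʳ L))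
            ; ⁻¹-cong = λ {L} {M} L≈M → wrap (negL-cong {L} {M} (unwrap L≈M)) }
          ; comm = λ L M → wrap (+L-comm L M) }
        ; *-cong = λ {L} {L′} {M} {M′} L≈L′ M≈M′ →
            wrap (*L-cong {L} {L′} {M} {M′} (unwrap L≈L′) (unwrap M≈M′))
        ; *-assoc = λ L M N → wrap (*L-assoc L M N)
        ; *-identity = (λ L → wrap (*L-identityˡ L)) , (λ L → wrap (*L-identityʳ L))
        ; distrib = (λ L M N → wrap (*L-distribˡ-+L L M N)) , (λ L M N → wrap (*L-distribʳ-+L L M N)) }
      ; *-comm = λ L M → wrap (*L-comm L M) } }

module Valuation {c ℓ} (R : CommutativeRing c ℓ) where
  open CommutativeRing R
  open LaurentSeries R
  open Sequences R
  open LaurentRing R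
  open import Relation.Binary.Reasoning.Setoid setoid

  VanishesAbove : Laurent → ℤ → Set ℓ
  VanishesAbove L w = ∀ z → w ℤ.< z → coeff L z ≈ 0#

  vanishesAbove⇒vanishesBelow : ∀ e a p → VanishesAbove (mkL e a) (+ e ℤ.- + p) → VanishesBelow p a
  vanishesAbove⇒vanishesBelow e a p a≈0 i i<p = begin
    a i                          ≡⟨ coeff-mkL-at e a i ⟨
    coeff (mkL e a) (+ e ℤ.- + i) ≈⟨ a≈0 _ (ℤP.+-monoʳ-< (+ e) (ℤP.neg-mono-< (ℤ.+<+ i<p))) ⟩
    0#                           ∎

  vanishesBelow⇒vanishesAbove : ∀ e a p → VanishesBelow p a → VanishesAbove (mkL e a) (+ e ℤ.- + p)
  vanishesBelow⇒vanishesAbove e a p a≈0 z e-p<z = begin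
    coeff (mkL e a) z     ≡⟨ coeff-mkL e a z ⟩
    seqAt a (+ e ℤ.- z)   ≈⟨ seqAt-below (+ e ℤ.- z) e-z<p ⟩
    0#                    ∎
    where
    e-z<p : + e ℤ.- z ℤ.< + p
    e-z<p = P.subst (+ e ℤ.- z ℤ.<_) (m-[m-n]≡n (+ e) (+ p)) (ℤP.+-monoʳ-< (+ e) (ℤP.neg-mono-< e-p<z))
    seqAt-below : ∀ w → w ℤ.< + p → seqAt a w ≈ 0#
    seqAt-below (+ i)    (ℤ.+<+ i<p) = a≈0 i i<p
    seqAt-below -[1+ _ ] _           = refl

  *L-leading : ∀ L M p q {w w′} → w ≡ + top L ℤ.- + p → w′ ≡ + top M ℤ.- + q →
    VanishesAbove L w → VanishesAbove M w′ →
    VanishesAbove (L *L M) (w ℤ.+ w′) × coeff (L *L M) (w ℤ.+ w′) ≈ coeff L w * coeff M w′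
  *L-leading (mkL e a) (mkL f b) p q P.refl P.refl L≈0 M≈0 =
    P.subst (VanishesAbove (mkL e a *L mkL f b)) (P.sym exponent≡)
      (vanishesBelow⇒vanishesAbove (e ℕ.+ f) (conv a b) (p ℕ.+ q) (proj₁ conv-lead)) ,
    (begin
      coeff (mkL e a *L mkL f b) ((+ e ℤ.- + p) ℤ.+ (+ f ℤ.- + q))
        ≡⟨ P.cong (coeff (mkL e a *L mkL f b)) exponent≡ ⟩
      coeff (mkL e a *L mkL f b) (+ (e ℕ.+ f) ℤ.- + (p ℕ.+ q))
        ≡⟨ coeff-mkL-at (e ℕ.+ f) (conv a b) (p ℕ.+ q) ⟩
      conv a b (p ℕ.+ q)
        ≈⟨ proj₂ conv-lead ⟩
      a p * b q
        ≡⟨ P.cong₂ _*_ (coeff-mkL-at e a p) (coeff-mkL-at f b q) ⟨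
      coeff (mkL e a) (+ e ℤ.- + p) * coeff (mkL f b) (+ f ℤ.- + q) ∎)
    where
    conv-lead = conv-vanishesBelow p q a b (vanishesAbove⇒vanishesBelow e a p L≈0)
                                           (vanishesAbove⇒vanishesBelow f b q M≈0)
    exponent≡ : (+ e ℤ.- + p) ℤ.+ (+ f ℤ.- + q) ≡ + (e ℕ.+ f) ℤ.- + (p ℕ.+ q)
    exponent≡ = [m-n]+[p-q]≡[m+p]-[n+q] (+ e) (+ p) (+ f) (+ q)

  nonzeroCoeff⇒≤top : ∀ L w → ¬ coeff L w ≈ 0# → ∃ λ p → w ≡ + top L ℤ.- + p
  nonzeroCoeff⇒≤top (mkL e a) w c≉0 with + e ℤ.- w in e-w≡
  ... | + p      = p , P.trans (P.sym (m-[m-n]≡n (+ e) w)) (P.cong (λ d → + e ℤ.- d) e-w≡)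
  ... | -[1+ _ ] = ⊥-elim (c≉0 refl)

  ν∞-resp-≋ : ∀ {L M w} → L ≋ M → ν∞≡ L w → ν∞≡ M w
  ν∞-resp-≋ {w = w} L≋M (L≉0 , L≈0) =
    (λ M≈0 → L≉0 (trans (L≋M w) M≈0)) , (λ z w<z → trans (sym (L≋M z)) (L≈0 z w<z))

  IsPolynomial : Laurent → Set ℓ
  IsPolynomial L = ∀ m → coeff L -[1+ m ] ≈ 0#

  isPolynomial⇒vanishesAfter : ∀ e a → IsPolynomial (mkL e a) → VanishesAfter e a
  isPolynomial⇒vanishesAfter e a a≈0 i e<i = begin
    a i                              ≡⟨ P.cong a (P.trans (ℕP.+-suc e k) (ℕP.m+[n∸m]≡n e<i)) ⟨
    a (e ℕ.+ suc k)                  ≡⟨ coeff-mkL e a -[1+ k ] ⟨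
    coeff (mkL e a) -[1+ k ]         ≈⟨ a≈0 k ⟩
    0#                               ∎
    where
    k = i ∸ suc e

  vanishesAfter⇒isPolynomial : ∀ e a → VanishesAfter e a → IsPolynomial (mkL e a)
  vanishesAfter⇒isPolynomial e a a≈0 m =
    trans (reflexive (coeff-mkL e a -[1+ m ])) (a≈0 (e ℕ.+ suc m) (ℕP.m<m+n e (s≤s z≤n)))

  isPolynomial-*L : ∀ L M → IsPolynomial L → IsPolynomial M → IsPolynomial (L *L M)
  isPolynomial-*L (mkL e a) (mkL f b) L-poly M-poly =
    vanishesAfter⇒isPolynomial (e ℕ.+ f) (conv a b)
      (conv-vanishesAfter e f a b (isPolynomial⇒vanishesAfter e a L-poly) (isPolynomial⇒vanishesAfter f b M-poly))

  isPolynomial-+L : ∀ L M → IsPolynomial L → IsPolynomial M → IsPolynomial (L +L M)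
  isPolynomial-+L L M L-poly M-poly m =
    trans (coeff-+L L M -[1+ m ]) (trans (+-cong (L-poly m) (M-poly m)) (+-identityˡ 0#))

  isPolynomial-resp-≋ : ∀ {L M} → L ≋ M → IsPolynomial L → IsPolynomial M
  isPolynomial-resp-≋ L≋M L-poly m = trans (sym (L≋M -[1+ m ])) (L-poly m)

  private
    frac-kept : ∀ e a i → e < i → co (frac (mkL e a)) i ≈ a i
    frac-kept e a i e<i with e <? i
    ... | yes _   = refl
    ... | no  e≮i = ⊥-elim (e≮i e<i)

    frac-dropped : ∀ e a i → i ≤ e → co (frac (mkL e a)) i ≈ 0#
    frac-dropped e a i i≤e with e <? i
    ... | yes e<i = ⊥-elim (ℕP.≤⇒≯ i≤e e<i)
    ... | no  _   = refl

  coeff-frac-<0 : ∀ L m → coeff (frac L) -[1+ m ] ≈ coeff L -[1+ m ]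
  coeff-frac-<0 (mkL e a) m = begin
    coeff (frac (mkL e a)) -[1+ m ]   ≡⟨ coeff-mkL e (co (frac (mkL e a))) -[1+ m ] ⟩
    co (frac (mkL e a)) (e ℕ.+ suc m) ≈⟨ frac-kept e a (e ℕ.+ suc m) (ℕP.m<m+n e (s≤s z≤n)) ⟩
    a (e ℕ.+ suc m)                   ≡⟨ coeff-mkL e a -[1+ m ] ⟨
    coeff (mkL e a) -[1+ m ]          ∎

  coeff-frac-≥0 : ∀ L n → coeff (frac L) (+ n) ≈ 0#
  coeff-frac-≥0 (mkL e a) n =
    trans (reflexive (coeff-mkL e _ (+ n))) (seqAt-frac (+ e ℤ.- + n) (ℤP.i-j≤i (+ e) (+ n)))
    where
    seqAt-frac : ∀ w → w ℤ.≤ + e → seqAt (co (frac (mkL e a))) w ≈ 0#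
    seqAt-frac (+ i)    (ℤ.+≤+ i≤e) = frac-dropped e a i i≤e
    seqAt-frac -[1+ _ ] _           = refl

module RemainderIdentities {c ℓ} (R : CommutativeRing c ℓ) where
  open CommutativeRing R
  open import Relation.Binary.Reasoning.Setoid setoid
  open import Algebra.Properties.Ring ring using (-‿involutive; -‿distribˡ-*; -‿distribʳ-*; -‿+-comm)
  open import Algebra.Properties.CommutativeSemigroup +-commutativeSemigroup using (interchange)

  -- Multiply t (A + t′) = 1 by e′ and use t e′ = - e.
  remainder-step : ∀ A e e′ t t′ → e ≈ - (t * e′) → t * (A + t′) ≈ 1# → A * e + e′ ≈ - (t′ * e)
  remainder-step A e e′ t t′ e≈-te′ t[A+t′]≈1 = begin
    A * e + e′                         ≈⟨ +-congˡ e′≈-eA-et′ ⟩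
    A * e + (- (e * A) + - (e * t′))   ≈⟨ +-assoc _ _ _ ⟨
    (A * e + - (e * A)) + - (e * t′)   ≈⟨ +-congʳ (trans (+-congˡ (-‿cong (*-comm e A))) (-‿inverseʳ (A * e))) ⟩
    0# + - (e * t′)                    ≈⟨ +-identityˡ _ ⟩
    - (e * t′)                         ≈⟨ -‿cong (*-comm e t′) ⟩
    - (t′ * e)                         ∎
    where
    e′≈-eA-et′ : e′ ≈ - (e * A) + - (e * t′)
    e′≈-eA-et′ = begin
      e′                        ≈⟨ *-identityʳ e′ ⟨
      e′ * 1#                   ≈⟨ *-congˡ t[A+t′]≈1 ⟨
      e′ * (t * (A + t′))       ≈⟨ *-assoc e′ t _ ⟨
      (e′ * t) * (A + t′)       ≈⟨ *-congʳ (trans (*-comm e′ t) (trans (sym (-‿involutive _))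
                                                                       (-‿cong (sym e≈-te′)))) ⟩
      (- e) * (A + t′)          ≈⟨ -‿distribˡ-* e _ ⟨
      - (e * (A + t′))          ≈⟨ -‿cong (distribˡ e A t′) ⟩
      - (e * A + e * t′)        ≈⟨ -‿+-comm _ _ ⟨
      - (e * A) + - (e * t′)    ∎

  difference-step : ∀ A F F′ e e′ t →
    (A * F + F′) * t + - (A * e + e′) ≈ A * (F * t + - e) + (F′ * t + - e′)
  difference-step A F F′ e e′ t = begin
    (A * F + F′) * t + - (A * e + e′)              ≈⟨ +-cong (distribʳ t (A * F) F′) (sym (-‿+-comm (A * e) e′)) ⟩
    ((A * F) * t + F′ * t) + (- (A * e) + - e′)    ≈⟨ interchange _ _ _ _ ⟩
    ((A * F) * t + - (A * e)) + (F′ * t + - e′)    ≈⟨ +-congʳ (+-cong (*-assoc A F t) (-‿distribʳ-* A e)) ⟩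
    (A * (F * t) + A * - e) + (F′ * t + - e′)      ≈⟨ +-congʳ (distribˡ A (F * t) (- e)) ⟨
    A * (F * t + - e) + (F′ * t + - e′)            ∎

  x≈-[x*-1] : ∀ x → x ≈ - (x * - 1#)
  x≈-[x*-1] x = begin
    x                ≈⟨ *-identityʳ x ⟨
    x * 1#           ≈⟨ -‿involutive _ ⟨
    - - (x * 1#)     ≈⟨ -‿cong (-‿distribʳ-* x 1#) ⟩
    - (x * - 1#)     ∎

  0*x+--1≈1 : ∀ x → 0# * x + - (- 1#) ≈ 1#
  0*x+--1≈1 x = trans (+-cong (zeroˡ x) (-‿involutive 1#)) (+-identityˡ 1#)

  1*x+-x≈0 : ∀ x → 1# * x + - x ≈ 0#
  1*x+-x≈0 x = trans (+-congʳ (*-identityˡ x)) (-‿inverseʳ x)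

module ContinuedFraction {c ℓ} (K : Field c ℓ) where
  open Field K
  open LaurentSeries commutativeRing
  open Sequences commutativeRing using (sumTo-zero; sumTo-single)
  open LaurentRing commutativeRing
  open Valuation commutativeRing
  open RemainderIdentities laurentRing
  open import Relation.Binary.Reasoning.Setoid setoid
  open import Algebra.Properties.Ring ring using (-0#≈0#; -‿involutive)
  open import Algebra.Properties.Group (CommutativeRing.+-group laurentRing) using (//-rightDividesˡ)

  *-nonzero : ∀ {x y} → ¬ x ≈ 0# → ¬ y ≈ 0# → ¬ x * y ≈ 0#
  *-nonzero {x} {y} x≉0 y≉0 xy≈0 with inverse x x≉0
  ... | x⁻¹ , xx⁻¹≈1 = y≉0 (begin
    y               ≈⟨ *-identityˡ y ⟨
    1# * y          ≈⟨ *-congʳ (trans (sym xx⁻¹≈1) (*-comm x x⁻¹)) ⟩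
    (x⁻¹ * x) * y   ≈⟨ *-assoc x⁻¹ x y ⟩
    x⁻¹ * (x * y)   ≈⟨ *-congˡ xy≈0 ⟩
    x⁻¹ * 0#        ≈⟨ zeroʳ x⁻¹ ⟩
    0#              ∎)

  ν∞-*L : ∀ {L M w w′} → ν∞≡ L w → ν∞≡ M w′ → ν∞≡ (L *L M) (w ℤ.+ w′)
  ν∞-*L {L} {M} {w} {w′} (L≉0 , L≈0) (M≉0 , M≈0)
    with nonzeroCoeff⇒≤top L w L≉0 | nonzeroCoeff⇒≤top M w′ M≉0
  ... | p , w≡ | q , w′≡ =
    (λ LM≈0 → *-nonzero L≉0 M≉0 (trans (sym (proj₂ product)) LM≈0)) , proj₁ product
    where
    product = *L-leading L M p q w≡ w′≡ L≈0 M≈0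

  ν∞-negL : ∀ {L w} → ν∞≡ L w → ν∞≡ (negL L) w
  ν∞-negL {L} {w} (L≉0 , L≈0) =
    (λ -L≈0 → L≉0 (-x≈0⇒x≈0 (trans (sym (coeff-negL L w)) -L≈0))) ,
    (λ z w<z → trans (coeff-negL L z) (trans (-‿cong (L≈0 z w<z)) -0#≈0#))
    where
    -x≈0⇒x≈0 : ∀ {x} → - x ≈ 0# → x ≈ 0#
    -x≈0⇒x≈0 {x} -x≈0 = trans (sym (-‿involutive x)) (trans (-‿cong -x≈0) -0#≈0#)

  ν∞-1L : ν∞≡ 1L (+ 0)
  ν∞-1L = 1≉0 , vanishes
    where
    vanishes : VanishesAbove 1L (+ 0)
    vanishes (+ zero)  (ℤ.+<+ ())
    vanishes (+ suc _) _          = refl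

  module Remainders (u v : ℕ → Carrier) (θ : ℕ → Laurent)
                    (θ-overline : ∀ i → InOverline (θ i))
                    (θ-step : ∀ i → (θ i *L (linL (u (suc i)) (v (suc i)) +L θ (suc i))) ≋ 1L) where

    A : ℕ → Laurent
    A i = linL (u i) (v i)

    -- The constant term of θ i (A (suc i) + θ (suc i)) = 1 is the X⁻¹-coefficient of θ i
    -- times the X-coefficient of A (suc i) + θ (suc i).
    θ-valuation : ∀ i → ν∞≡ (θ i) -[1+ 0 ]
    θ-valuation i = t≉0 , θ-vanishes
      where
      M = A (suc i) +L θ (suc i)
      θ-vanishes : VanishesAbove (θ i) -[1+ 0 ]
      θ-vanishes (+ n)    _          = θ-overline i n
      θ-vanishes -[1+ _ ] (ℤ.-<- ())
      M-vanishes : VanishesAbove M (+ 1)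
      M-vanishes (+ suc (suc k)) (ℤ.+<+ (s≤s (s≤s _))) =
        trans (coeff-+L (A (suc i)) (θ (suc i)) (+ suc (suc k)))
              (trans (+-congˡ (θ-overline (suc i) (suc (suc k)))) (+-identityʳ _))
      constant-term : coeff (θ i *L M) (+ 0) ≈ coeff (θ i) -[1+ 0 ] * coeff M (+ 1)
      constant-term = proj₂ (*L-leading (θ i) M (suc (top (θ i))) (top (θ (suc i)))
        (P.sym (m-[1+m]≡-1 (+ top (θ i)))) (P.sym ([m+n]-n≡m (+ 1) (+ top (θ (suc i))))) θ-vanishes M-vanishes)
      t≉0 : ¬ coeff (θ i) -[1+ 0 ] ≈ 0#
      t≉0 t≈0 = 1≉0 (begin
        1#                                      ≈⟨ θ-step i (+ 0) ⟨
        coeff (θ i *L M) (+ 0)                  ≈⟨ constant-term ⟩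
        coeff (θ i) -[1+ 0 ] * coeff M (+ 1)    ≈⟨ *-congʳ t≈0 ⟩
        0# * coeff M (+ 1)                      ≈⟨ zeroˡ _ ⟩
        0#                                      ∎)

    -- (ε (n - 1) , ε n), like fibPair, with ε (-1) = -1 and ε 0 = θ 0.
    remainders : ℕ → Laurent × Laurent
    remainders zero    = negL 1L , θ 0
    remainders (suc n) = proj₂ (remainders n) , ((A (suc n) *L proj₂ (remainders n)) +L proj₁ (remainders n))

    εprev ε : ℕ → Laurent
    εprev n = proj₁ (remainders n)
    ε     n = proj₂ (remainders n)

    ε-step : ∀ n → ε n ≋ negL (θ n *L εprev n)
    ε-step zero    = unwrap (x≈-[x*-1] (θ 0))
    ε-step (suc n) = unwrap (remainder-step (A (suc n)) (ε n) (εprev n) (θ n) (θ (suc n))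
                                            (wrap (ε-step n)) (wrap (θ-step n)))

    εprev-valuation : ∀ n → ν∞≡ (εprev n) (ℤ.- (+ n))
    ε-valuation : ∀ n → ν∞≡ (ε n) -[1+ n ]

    εprev-valuation zero    = ν∞-negL ν∞-1L
    εprev-valuation (suc n) = ε-valuation n

    ε-valuation n = ν∞-resp-≋ (≋-sym (ε-step n))
      (P.subst (ν∞≡ _) (-1-n≡-[1+n] n) (ν∞-negL (ν∞-*L (θ-valuation n) (εprev-valuation n))))
      where
      -1-n≡-[1+n] : ∀ n → -[1+ 0 ] ℤ.+ ℤ.- (+ n) ≡ -[1+ n ]
      -1-n≡-[1+n] zero    = P.refl
      -1-n≡-[1+n] (suc n) = P.refl

    Fprev : ℕ → Laurent
    Fprev n = proj₁ (fibPair A n)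

    Dprev D : ℕ → Laurent
    Dprev n = (Fprev n *L θ 0) +L negL (εprev n)
    D     n = (Fib A n *L θ 0) +L negL (ε n)

    -- D n = F n θ 0 - ε n obeys the recurrence of F n, with the polynomial initial values 1 and 0.
    D-isPolynomial : ∀ n → IsPolynomial (Dprev n) × IsPolynomial (D n)
    D-isPolynomial zero =
      isPolynomial-resp-≋ (≋-sym (unwrap (0*x+--1≈1 (θ 0)))) (λ _ → refl) ,
      isPolynomial-resp-≋ (≋-sym (unwrap (1*x+-x≈0 (θ 0)))) (λ m → coeff-0L -[1+ m ])
    D-isPolynomial (suc n) = proj₂ IH ,
      isPolynomial-resp-≋ (≋-sym (unwrap (difference-step (A (suc n)) (Fib A n) (Fprev n) (ε n) (εprev n) (θ 0))))
        (isPolynomial-+L (A (suc n) *L D n) (Dprev n) (isPolynomial-*L (A (suc n)) (D n) (λ _ → refl) (proj₂ IH)) (proj₁ IH))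
      where
      IH = D-isPolynomial n

    Fθ-fractional : ∀ i m → coeff (Fib A i *L θ 0) -[1+ m ] ≈ coeff (ε i) -[1+ m ]
    Fθ-fractional i m = begin
      coeff (Fib A i *L θ 0) -[1+ m ]                        ≈⟨ unwrap (//-rightDividesˡ (ε i) (Fib A i *L θ 0)) -[1+ m ] ⟨
      coeff (D i +L ε i) -[1+ m ]                            ≈⟨ coeff-+L (D i) (ε i) -[1+ m ] ⟩
      coeff (D i) -[1+ m ] + coeff (ε i) -[1+ m ]            ≈⟨ +-congʳ (proj₂ (D-isPolynomial i) m) ⟩
      0# + coeff (ε i) -[1+ m ]                              ≈⟨ +-identityˡ _ ⟩
      coeff (ε i) -[1+ m ]                                   ∎

    zeck-fractional : ∀ {φ} → θ 0 ≋ φ → ∀ z r m →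
      coeff (frac (zeck A z r *L φ)) -[1+ m ] ≈ sumTo r (λ i → z i * coeff (ε i) -[1+ m ])
    zeck-fractional {φ} θ₀≋φ z r m = begin
      coeff (frac (zeck A z r *L φ)) -[1+ m ]  ≈⟨ coeff-frac-<0 (zeck A z r *L φ) m ⟩
      coeff (zeck A z r *L φ) -[1+ m ]         ≈⟨ *L-cong {zeck A z r} (≋-refl {zeck A z r}) (≋-sym {θ 0} θ₀≋φ) -[1+ m ] ⟩
      coeff (zeck A z r *L θ 0) -[1+ m ]       ≈⟨ partialSum r ⟩
      sumTo r (λ i → z i * coeff (ε i) -[1+ m ]) ∎
      where
      term : ∀ i → coeff ((constL (z i) *L Fib A i) *L θ 0) -[1+ m ] ≈ z i * coeff (ε i) -[1+ m ]
      term i = trans (*L-assoc (constL (z i)) (Fib A i) (θ 0) -[1+ m ])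
                     (trans (coeff-constL-*L (z i) (Fib A i *L θ 0) -[1+ m ]) (*-congˡ (Fθ-fractional i m)))
      partialSum : ∀ r → coeff (zeck A z r *L θ 0) -[1+ m ] ≈ sumTo r (λ i → z i * coeff (ε i) -[1+ m ])
      partialSum zero    = term 0
      partialSum (suc r) = trans (*L-distribʳ-+L (θ 0) (zeck A z r) _ -[1+ m ])
        (trans (coeff-+L (zeck A z r *L θ 0) _ -[1+ m ]) (+-cong (partialSum r) (term (suc r))))

    module _ (z : ℕ → Carrier) (j : ℕ) (z<j≈0 : ∀ i → i < j → z i ≈ 0#) where

      private
        term≈0 : ∀ i m → i < j ⊎ m < i → z i * coeff (ε i) -[1+ m ] ≈ 0#
        term≈0 i m (inj₁ i<j) = trans (*-congʳ (z<j≈0 i i<j)) (zeroˡ _)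
        term≈0 i m (inj₂ m<i) = trans (*-congˡ (proj₂ (ε-valuation i) -[1+ m ] (ℤ.-<- m<i))) (zeroʳ _)

      sumTo-lowestTerm : ∀ r → j ≤ r → sumTo r (λ i → z i * coeff (ε i) -[1+ j ]) ≈ z j * coeff (ε j) -[1+ j ]
      sumTo-lowestTerm r j≤r = sumTo-single r j _ j≤r (λ i _ i≢j → term≈0 i j (≢⇒<⊎> i≢j))
        where
        ≢⇒<⊎> : ∀ {i} → i ≢ j → i < j ⊎ j < i
        ≢⇒<⊎> {i} i≢j with ℕP.<-cmp i j
        ... | tri< i<j _   _ = inj₁ i<j
        ... | tri≈ _   i≡j _ = ⊥-elim (i≢j i≡j)
        ... | tri> _   _ j<i = inj₂ j<i

      sumTo-belowLowest : ∀ r m → m < j → sumTo r (λ i → z i * coeff (ε i) -[1+ m ]) ≈ 0#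
      sumTo-belowLowest r m m<j = sumTo-zero r _ (λ i _ → term≈0 i m (below i))
        where
        below : ∀ i → i < j ⊎ m < i
        below i with i <? j
        ... | yes i<j = inj₁ i<j
        ... | no  i≮j = inj₂ (ℕP.<-≤-trans m<j (ℕP.≮⇒≥ i≮j))

lemma2 : ∀ {c ℓ} (K : Field c ℓ) →
    let open Field K
        open LaurentSeries commutativeRing
    in (u v : ℕ → Carrier) →
       (∀ i → ¬ (u (suc i) ≈ 0#)) →
       (φ : Laurent) → InOverline φ →
       IsCF (λ i → linL (u i) (v i)) φ →
       (r : ℕ) (z : ℕ → Carrier) → ¬ (z r ≈ 0#) →
       (j : ℕ) → j ≤ r → ¬ (z j ≈ 0#) → (∀ i → i < j → z i ≈ 0#) →
       ν∞≡ (frac (zeck (λ i → linL (u i) (v i)) z r *L φ)) (-[1+ j ])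
lemma2 K u v _ φ _ (θ , θ₀≋φ , θ-overline , θ-step) r z _ j j≤r zⱼ≉0 z<j≈0 = lowest≉0 , higher≈0
  where
  open Field K
  open LaurentSeries commutativeRing
  open Valuation commutativeRing using (coeff-frac-≥0)
  open ContinuedFraction K using (*-nonzero)
  open ContinuedFraction.Remainders K u v θ θ-overline θ-step
  open import Relation.Binary.Reasoning.Setoid setoid

  N = zeck A z r

  lowest≉0 : ¬ coeff (frac (N *L φ)) -[1+ j ] ≈ 0#
  lowest≉0 c≈0 = *-nonzero zⱼ≉0 (proj₁ (ε-valuation j)) (begin
    z j * coeff (ε j) -[1+ j ]                  ≈⟨ sumTo-lowestTerm z j z<j≈0 r j≤r ⟨
    sumTo r (λ i → z i * coeff (ε i) -[1+ j ])  ≈⟨ zeck-fractional θ₀≋φ z r j ⟨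
    coeff (frac (N *L φ)) -[1+ j ]              ≈⟨ c≈0 ⟩
    0#                                          ∎)

  higher≈0 : ∀ w → -[1+ j ] ℤ.< w → coeff (frac (N *L φ)) w ≈ 0#
  higher≈0 (+ n)      _           = coeff-frac-≥0 (N *L φ) n
  higher≈0 -[1+ m ] (ℤ.-<- m<j) = trans (zeck-fractional θ₀≋φ z r m) (sumTo-belowLowest z j z<j≈0 r m m<j)
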